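{- Let $\mathcal A_n=\mathrm{Av}_n(123,132)$. Then $\mathrm{pop}_{\mathcal A}(312)=\mathrm{pop}_{\mathcal A}(213)=1/4$.
   Context: A permutation $\pi=a_1\dots a_n$ contains a consecutive occurrence of a pattern $p\in\mathcal S_r$ at position $i$ if $a_i\dots a_{i+r-1}$ is order-isomorphic to $p$; $\mathrm{Av}_n(p_1,\dots,p_k)$ is the set of permutations of size $n$ with no consecutive occurrence of any $p_j$. For a class $\mathcal A_n$ and a pattern $p$, $\mathbf p_n^{\mathcal A}$ is the total number of consecutive occurrences of $p$ over all permutations of $\mathcal A_n$, and $\mathrm{pop}_{\mathcal A}(p)=\lim_{n\to\infty}\frac{\mathbf p_n^{\mathcal A}}{n|\mathcal A_n|}$ when it exists. -}

module Defs where

open import Data.Nat using (ℕ; zero; suc; _<ᵇ_; _≡ᵇ_)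
open import Data.Bool using (Bool; true; false; _∧_; not)
open import Data.List using (List; []; _∷_; map; concatMap; filter; length; sum; upTo; zip; all; any; take; drop)
open import Data.Product using (_,_; ∃; _×_)
open import Data.Integer using (+_)
open import Data.Rational using (ℚ; _/_; 0ℚ; _-_; ∣_∣; _<_)
open import Data.Nat using (_≤_)
import Data.Nat as ℕ
open import Relation.Nullary.Decidable using (T?)
open import Data.Bool using (T)

_==_ : Bool → Bool → Bool
true == b = b
false == b = not b

words : ℕ → ℕ → List (List ℕ)
words n zero = [] ∷ []
words n (suc k) = concatMap (λ w → map (λ x → x ∷ w) (upTo n)) (words n k)

distinct : List ℕ → Bool
distinct [] = true
distinct (x ∷ xs) = not (any (λ y → x ≡ᵇ y) xs) ∧ distinct xs

-- S_n : all permutations of size n, written in one-line notation a₁…aₙ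
-- with values 0,…,n-1 (each exactly once in the list)
perms : ℕ → List (List ℕ)
perms n = filter (λ w → T? (distinct w)) (words n n)

orderIso : List ℕ → List ℕ → Bool
orderIso [] [] = true
orderIso (a ∷ as) (b ∷ bs) =
  all (λ { (x , y) → ((a <ᵇ x) == (b <ᵇ y)) ∧ ((x <ᵇ a) == (y <ᵇ b)) }) (zip as bs)
  ∧ orderIso as bs
orderIso _ _ = false

windows : ℕ → List ℕ → List (List ℕ)
windows r [] = []
windows r (x ∷ xs) with length (take r (x ∷ xs)) ≡ᵇ r
... | true  = take r (x ∷ xs) ∷ windows r xs
... | false = []

occ : List ℕ → List ℕ → ℕ
occ p π = length (filter (λ w → T? (orderIso p w)) (windows (length p) π))

avoidsAll : List (List ℕ) → List ℕ → Bool
avoidsAll ps π = all (λ p → occ p π ≡ᵇ 0) ps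

Av : List (List ℕ) → ℕ → List (List ℕ)
Av ps n = filter (λ π → T? (avoidsAll ps π)) (perms n)

totalOcc : List (List ℕ) → List ℕ → ℕ → ℕ
totalOcc ps p n = sum (map (occ p) (Av ps n))

-- p_n / (n |A_n|)  (defined as 0 when the denominator vanishes)
popRatio : List (List ℕ) → List ℕ → ℕ → ℚ
popRatio ps p n with n ℕ.* length (Av ps n)
... | zero  = 0ℚ
... | suc d = (+ totalOcc ps p n) / suc d

ConvergesTo : (ℕ → ℚ) → ℚ → Set
ConvergesTo a L = ∀ (ε : ℚ) → 0ℚ < ε → ∃ λ N → ∀ n → N ≤ n → ∣ a n - L ∣ < ε

PopEq : List (List ℕ) → List ℕ → ℚ → Set
PopEq ps p L = ConvergesTo (popRatio ps p) L

module Submission where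

-- In a permutation with no consecutive 123 or 132 the entry 0 is one of the last two entries, since
-- otherwise it starts an occurrence of one of them. Deleting it, together with the entry after it,
-- builds Av(n+2) from Av(n+1) and n+1 copies of Av(n), so |Av(n)| is the involution number I(n),
-- I(n+2) = I(n+1) + (n+1) I(n). Every window except the last one is inherited, so the total number
-- Q(n) of 312 (or of 213) occurrences satisfies the same recurrence up to a term counting the new
-- windows. Hence D(n) = 4 Q(n) − n I(n) satisfies |D(n+2)| ≤ |D(n+1)| + (n+1) |D(n)| + O(n I(n−1)),
-- and as I(n+1)/I(n) ≥ √n the inhomogeneous term is eventually negligible: D(n) = o(n I(n)), which
-- says Q(n)/(n I(n)) → 1/4.

open import Defs
open import Function using (_∘_)
open import Function.Bundles using (Equivalence; mk⇔)
open import Data.Empty using (⊥; ⊥-elim)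
open import Data.Unit using (tt)
open import Data.Product using (_×_; _,_; proj₁; proj₂; ∃-syntax)
open import Data.Sum using (inj₁; inj₂)
open import Data.Bool using (Bool; true; false; T; _∧_; not)
open import Data.Bool.Properties using (∧-zeroʳ; T-∧)
open import Data.Nat
  using (ℕ; zero; suc; pred; _+_; _*_; _⊓_; _⊔_; ∣_-_∣; _≤_; _<_; z≤n; s≤s; s≤s⁻¹; z<s; _<ᵇ_; _≡ᵇ_)
open import Data.Nat.Properties
open import Data.Nat.Tactic.RingSolver using (solve-∀)
open import Data.Nat.Coprimality using (Coprime)
open import Data.Nat.ListAction using (sum)
open import Data.Nat.ListAction.Properties using (sum-++; sum-↭)
open import Algebra.Properties.CommutativeSemigroup +-commutativeSemigroup using (interchange)
open import Data.Integer as ℤ using (_⊖_)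
import Data.Integer.Properties as ℤ
open import Data.Integer.Tactic.RingSolver using () renaming (solve-∀ to ℤ-solve-∀)
open import Data.Rational as ℚ using (mkℚ; _/_)
import Data.Rational.Properties as ℚ
import Data.Rational.Unnormalised as ℚᵘ
import Data.Rational.Unnormalised.Properties as ℚᵘ
open import Data.List using (List; []; _∷_; _++_; _∷ʳ_; map; length; downFrom; upTo; any)
open import Data.List.Properties
  using (map-++; map-∘; map-cong; map-cong-local; map-id-local; map-injective; ++-assoc;
         ∷-injectiveˡ; ∷ʳ-injectiveˡ; ∷ʳ-injectiveʳ; length-++; length-++-sucʳ; length-map; length-downFrom)
open import Data.List.Relation.Unary.All as All using (All; []; _∷_)
import Data.List.Relation.Unary.All.Properties as All
open import Data.List.Relation.Unary.Any as Any using (here; there)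
open import Data.List.Relation.Unary.AllPairs as AllPairs using ([]; _∷_)
import Data.List.Relation.Unary.AllPairs.Properties as AllPairs
open import Data.List.Relation.Unary.Unique.Propositional using (Unique)
import Data.List.Relation.Unary.Unique.Propositional.Properties as Unique
open import Data.List.Membership.Propositional using (_∈_; find)
open import Data.List.Membership.Propositional.Properties
open import Data.List.Membership.Propositional.Properties.WithK using (unique∧set⇒bag)
open import Data.List.Membership.DecPropositional _≟_ using (_∈?_)
open import Data.List.Relation.Binary.Permutation.Propositional using (_↭_)
import Data.List.Relation.Binary.Permutation.Propositional.Properties as ↭
open import Data.List.Relation.Binary.BagAndSetEquality using (∼bag⇒↭)
open import Relation.Nullary using (¬_; Dec; yes; no)
open import Relation.Nullary.Decidable using (T?)
open import Relation.Binary.PropositionalEquality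
open import Relation.Binary.Definitions using (tri<; tri≈; tri>)

-- Windows and occurrences of patterns of length three

indicator : Bool → ℕ
indicator true  = 1
indicator false = 0

windowSum : (ℕ → ℕ → ℕ → ℕ) → List ℕ → ℕ
windowSum g (a ∷ b ∷ c ∷ π) = g a b c + windowSum g (b ∷ c ∷ π)
windowSum g _               = 0

occurs : List ℕ → ℕ → ℕ → ℕ → ℕ
occurs p a b c = indicator (orderIso p (a ∷ b ∷ c ∷ []))

occ≡windowSum : ∀ x y z π → occ (x ∷ y ∷ z ∷ []) π ≡ windowSum (occurs (x ∷ y ∷ z ∷ [])) π
occ≡windowSum x y z []          = refl
occ≡windowSum x y z (_ ∷ [])     = refl
occ≡windowSum x y z (_ ∷ _ ∷ []) = refl
occ≡windowSum x y z (a ∷ b ∷ c ∷ π)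
  with orderIso (x ∷ y ∷ z ∷ []) (a ∷ b ∷ c ∷ []) | occ≡windowSum x y z (b ∷ c ∷ π)
... | true  | ih = cong suc ih
... | false | ih = ih

occurs-≤1 : ∀ p a b c → occurs p a b c ≤ 1
occurs-≤1 p a b c with orderIso p (a ∷ b ∷ c ∷ [])
... | true  = ≤-refl
... | false = z≤n

windowSum-≤-length : ∀ {g} → (∀ a b c → g a b c ≤ 1) → ∀ π → windowSum g π ≤ length π
windowSum-≤-length g≤1 (a ∷ b ∷ c ∷ π) = +-mono-≤ (g≤1 a b c) (windowSum-≤-length g≤1 (b ∷ c ∷ π))
windowSum-≤-length g≤1 []          = z≤n
windowSum-≤-length g≤1 (_ ∷ [])     = z≤n
windowSum-≤-length g≤1 (_ ∷ _ ∷ []) = z≤n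

OrderEmbedding : (ℕ → ℕ) → Set
OrderEmbedding s = ∀ a b → (s a <ᵇ s b) ≡ (a <ᵇ b)

suc-embedding : OrderEmbedding suc
suc-embedding _ _ = refl

occurs-embedding : ∀ {s} → OrderEmbedding s → ∀ x y z a b c →
                   occurs (x ∷ y ∷ z ∷ []) (s a) (s b) (s c) ≡ occurs (x ∷ y ∷ z ∷ []) a b c
occurs-embedding {s} emb x y z a b c
  with s a <ᵇ s b | emb a b | s b <ᵇ s a | emb b a | s a <ᵇ s c | emb a c
     | s c <ᵇ s a | emb c a | s b <ᵇ s c | emb b c | s c <ᵇ s b | emb c b
... | _ | refl | _ | refl | _ | refl | _ | refl | _ | refl | _ | refl = refl

windowSum-map : ∀ {g s} → (∀ a b c → g (s a) (s b) (s c) ≡ g a b c) →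
                ∀ π → windowSum g (map s π) ≡ windowSum g π
windowSum-map inv (a ∷ b ∷ c ∷ π) = cong₂ _+_ (inv a b c) (windowSum-map inv (b ∷ c ∷ π))
windowSum-map inv []              = refl
windowSum-map inv (_ ∷ [])         = refl
windowSum-map inv (_ ∷ _ ∷ [])     = refl

windowSum-embedding : ∀ {s} → OrderEmbedding s → ∀ x y z σ →
                      windowSum (occurs (x ∷ y ∷ z ∷ [])) (map s σ) ≡ windowSum (occurs (x ∷ y ∷ z ∷ [])) σ
windowSum-embedding {s} emb x y z = windowSum-map (occurs-embedding {s} emb x y z)

-- junk value 0 for the empty list
lastEntry : List ℕ → ℕ
lastEntry []          = 0
lastEntry (a ∷ [])     = a
lastEntry (_ ∷ b ∷ π) = lastEntry (b ∷ π)

lastEntry-map : ∀ (s : ℕ → ℕ) a π → lastEntry (map s (a ∷ π)) ≡ s (lastEntry (a ∷ π))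
lastEntry-map s a []      = refl
lastEntry-map s a (b ∷ π) = lastEntry-map s b π

lastEntry-∷ʳ : ∀ π a → lastEntry (π ∷ʳ a) ≡ a
lastEntry-∷ʳ []          a = refl
lastEntry-∷ʳ (_ ∷ [])     a = refl
lastEntry-∷ʳ (_ ∷ b ∷ π) a = lastEntry-∷ʳ (b ∷ π) a

lastEntry-∈ : ∀ a π → lastEntry (a ∷ π) ∈ a ∷ π
lastEntry-∈ a []      = here refl
lastEntry-∈ a (b ∷ π) = there (lastEntry-∈ b π)

lastWindow : (ℕ → ℕ → ℕ → ℕ) → List ℕ → ℕ → ℕ
lastWindow g (a ∷ b ∷ [])     c = g a b c
lastWindow g (_ ∷ b ∷ c ∷ π) d = lastWindow g (b ∷ c ∷ π) d
lastWindow g _               _ = 0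

windowSum-∷ʳ : ∀ g π c → windowSum g (π ∷ʳ c) ≡ windowSum g π + lastWindow g π c
windowSum-∷ʳ g []              c = refl
windowSum-∷ʳ g (_ ∷ [])         c = refl
windowSum-∷ʳ g (a ∷ b ∷ [])     c = +-comm (g a b c) 0
windowSum-∷ʳ g (a ∷ b ∷ c ∷ π) d =
  trans (cong (g a b c +_) (windowSum-∷ʳ g (b ∷ c ∷ π) d)) (sym (+-assoc (g a b c) _ _))

lastWindow-zero : ∀ {g} → (∀ a b → g a b 0 ≡ 0) → ∀ π → lastWindow g π 0 ≡ 0
lastWindow-zero g0 (a ∷ b ∷ [])     = g0 a b
lastWindow-zero g0 (_ ∷ b ∷ c ∷ π) = lastWindow-zero g0 (b ∷ c ∷ π)
lastWindow-zero g0 []              = refl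
lastWindow-zero g0 (_ ∷ [])         = refl

lastWindow-∷ʳ : ∀ g a π b c → lastWindow g ((a ∷ π) ∷ʳ b) c ≡ g (lastEntry (a ∷ π)) b c
lastWindow-∷ʳ g a []          b c = refl
lastWindow-∷ʳ g a (x ∷ [])     b c = refl
lastWindow-∷ʳ g a (x ∷ y ∷ π) b c = lastWindow-∷ʳ g x (y ∷ π) b c

lastWindow-∷ʳ0 : ∀ {g} → (∀ b c → g b 0 c ≡ 0) → ∀ π c → lastWindow g (π ∷ʳ 0) c ≡ 0
lastWindow-∷ʳ0 g0 []      c = refl
lastWindow-∷ʳ0 g0 (a ∷ π) c = trans (lastWindow-∷ʳ _ a π 0 c) (g0 _ c)

windowSum-++ˡ : ∀ g π ρ → windowSum g ρ ≤ windowSum g (π ++ ρ)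
windowSum-++ˡ g []      ρ = ≤-refl
windowSum-++ˡ g (a ∷ π) ρ = ≤-trans (windowSum-++ˡ g π ρ) (windowSum-∷ g a (π ++ ρ))
  where
  windowSum-∷ : ∀ g a π → windowSum g π ≤ windowSum g (a ∷ π)
  windowSum-∷ g a []          = ≤-refl
  windowSum-∷ g a (_ ∷ [])     = ≤-refl
  windowSum-∷ g a (b ∷ c ∷ π) = m≤n+m _ _

windowSum-window : ∀ g π a b c ρ → g a b c ≤ windowSum g (π ++ a ∷ b ∷ c ∷ ρ)
windowSum-window g π a b c ρ = ≤-trans (m≤m+n (g a b c) _) (windowSum-++ˡ g π (a ∷ b ∷ c ∷ ρ))

<ᵇ≡true : ∀ {a b} → a < b → (a <ᵇ b) ≡ true
<ᵇ≡true {a} {b} a<b with a <ᵇ b | <⇒<ᵇ a<b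
... | true | _ = refl

<ᵇ≡false : ∀ {a b} → b ≤ a → (a <ᵇ b) ≡ false
<ᵇ≡false {a} {b} b≤a with a <ᵇ b in eq
... | true  = ⊥-elim (<⇒≱ (<ᵇ⇒< a b (subst T (sym eq) tt)) b≤a)
... | false = refl

p123 p132 p312 p213 : List ℕ
p123 = 1 ∷ 2 ∷ 3 ∷ []
p132 = 1 ∷ 3 ∷ 2 ∷ []
p312 = 3 ∷ 1 ∷ 2 ∷ []
p213 = 2 ∷ 1 ∷ 3 ∷ []

-- none of the four patterns ends with its smallest entry
occurs-endingAt0 : ∀ a b → occurs p123 a b 0 ≡ 0 × occurs p132 a b 0 ≡ 0
                         × occurs p312 a b 0 ≡ 0 × occurs p213 a b 0 ≡ 0
occurs-endingAt0 a b =
  cong indicator (∧-zeroʳ _) ,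
  cong (λ t → indicator (t ∧ ((0 <ᵇ b) ∧ true) ∧ true)) (∧-zeroʳ ((a <ᵇ b) ∧ not (b <ᵇ a))) ,
  cong indicator (∧-zeroʳ _) ,
  cong indicator (∧-zeroʳ _)

occurs-startingAt0 : ∀ y z → y ≢ z → 1 ≤ occurs p123 0 (suc y) (suc z) + occurs p132 0 (suc y) (suc z)
occurs-startingAt0 y z y≢z with <-cmp y z
... | tri< y<z _ _ rewrite <ᵇ≡true y<z | <ᵇ≡false (<⇒≤ y<z) = s≤s z≤n
... | tri≈ _ y≡z _ = ⊥-elim (y≢z y≡z)
... | tri> _ _ z<y rewrite <ᵇ≡true z<y | <ᵇ≡false (<⇒≤ z<y) = s≤s z≤n

occurs-312-through0 : ∀ a v → occurs p312 (suc a) 0 (suc v) ≡ indicator (v <ᵇ a)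
occurs-312-through0 a v with <-cmp a v
... | tri< a<v _ _ rewrite <ᵇ≡true a<v | <ᵇ≡false (<⇒≤ a<v) = refl
... | tri≈ _ refl _ rewrite <ᵇ≡false (≤-refl {a}) = refl
... | tri> _ _ v<a rewrite <ᵇ≡true v<a | <ᵇ≡false (<⇒≤ v<a) = refl

occurs-213-through0 : ∀ a v → occurs p213 (suc a) 0 (suc v) ≡ indicator (a <ᵇ v)
occurs-213-through0 a v with <-cmp a v
... | tri< a<v _ _ rewrite <ᵇ≡true a<v | <ᵇ≡false (<⇒≤ a<v) = refl
... | tri≈ _ refl _ rewrite <ᵇ≡false (≤-refl {a}) = refl
... | tri> _ _ v<a rewrite <ᵇ≡true v<a | <ᵇ≡false (<⇒≤ v<a) = refl

-- ℕ versions of Data.Fin's punchIn and punchOut: punchIn k skips the value k, punchOut k undoes it.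
punchIn : ℕ → ℕ → ℕ
punchIn zero    y       = suc y
punchIn (suc k) zero    = zero
punchIn (suc k) (suc y) = suc (punchIn k y)

punchOut : ℕ → ℕ → ℕ
punchOut zero    y       = pred y
punchOut (suc k) zero    = zero
punchOut (suc k) (suc y) = suc (punchOut k y)

punchIn-embedding : ∀ k → OrderEmbedding (punchIn k)
punchIn-embedding zero    a       b       = refl
punchIn-embedding (suc k) zero    zero    = refl
punchIn-embedding (suc k) zero    (suc b) = refl
punchIn-embedding (suc k) (suc a) zero    = refl
punchIn-embedding (suc k) (suc a) (suc b) = punchIn-embedding k a b

punchIn-injective : ∀ k {a b} → punchIn k a ≡ punchIn k b → a ≡ b
punchIn-injective zero    refl = refl
punchIn-injective (suc k) {zero}  {zero}  _  = refl
punchIn-injective (suc k) {suc a} {suc b} eq = cong suc (punchIn-injective k (suc-injective eq))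

punchIn≢ : ∀ k y → punchIn k y ≢ k
punchIn≢ zero    y       ()
punchIn≢ (suc k) (suc y) eq = punchIn≢ k y (suc-injective eq)

punchIn-punchOut : ∀ {k z} → z ≢ k → punchIn k (punchOut k z) ≡ z
punchIn-punchOut {zero}  {zero}  z≢k = ⊥-elim (z≢k refl)
punchIn-punchOut {zero}  {suc z} z≢k = refl
punchIn-punchOut {suc k} {zero}  z≢k = refl
punchIn-punchOut {suc k} {suc z} z≢k = cong suc (punchIn-punchOut (z≢k ∘ cong suc))

punchOut≢ : ∀ {k z w} → z ≢ k → z ≢ punchIn k w → punchOut k z ≢ w
punchOut≢ {k} z≢k z≢ eq = z≢ (trans (sym (punchIn-punchOut z≢k)) (cong (punchIn k) eq))

punchIn-< : ∀ k {y m} → y < m → punchIn k y < suc m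
punchIn-< zero    y<m = s≤s y<m
punchIn-< (suc k) {zero}  y<m = s≤s z≤n
punchIn-< (suc k) {suc y} (s≤s y<m) = s≤s (punchIn-< k y<m)

punchOut-< : ∀ {k z m} → z < suc m → z ≢ k → k ≤ m → punchOut k z < m
punchOut-< {zero}  {zero}  _         z≢k _   = ⊥-elim (z≢k refl)
punchOut-< {zero}  {suc z} (s≤s z<m) _   _   = z<m
punchOut-< {suc k} {zero}  _         _   k<m = ≤-trans (s≤s z≤n) k<m
punchOut-< {suc k} {suc z} {suc m} (s≤s z<m) z≢k (s≤s k≤m) = s≤s (punchOut-< z<m (z≢k ∘ cong suc) k≤m)

punchIn-<ᵇ : ∀ v ℓ → (punchIn v ℓ <ᵇ v) ≡ (ℓ <ᵇ v)
punchIn-<ᵇ zero    ℓ       = refl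
punchIn-<ᵇ (suc v) zero    = refl
punchIn-<ᵇ (suc v) (suc ℓ) = punchIn-<ᵇ v ℓ

<ᵇ-punchIn : ∀ v ℓ → (v <ᵇ punchIn v ℓ) ≡ (v <ᵇ suc ℓ)
<ᵇ-punchIn zero    ℓ       = refl
<ᵇ-punchIn (suc v) zero    = refl
<ᵇ-punchIn (suc v) (suc ℓ) = <ᵇ-punchIn v ℓ

punchOut-inverse : ∀ {w m a} → w ≤ m → All (_< suc m) a → All (_≢ w) a →
                   All (_< m) (map (punchOut w) a) × map (punchIn w) (map (punchOut w) a) ≡ a
punchOut-inverse w≤m a< a≢w =
  All.map⁺ (All.zipWith (λ (z< , z≢w) → punchOut-< z< z≢w w≤m) (a< , a≢w)) ,
  trans (sym (map-∘ _)) (map-id-local (All.map punchIn-punchOut a≢w))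

∑ : ∀ {A : Set} → List A → (A → ℕ) → ℕ
∑ xs f = sum (map f xs)

syntax ∑ xs (λ x → e) = ∑[ x ∈ xs ] e

module _ {A : Set} where

  ∑-++ : ∀ xs ys (f : A → ℕ) → ∑[ x ∈ xs ++ ys ] f x ≡ ∑[ x ∈ xs ] f x + ∑[ x ∈ ys ] f x
  ∑-++ xs ys f = trans (cong sum (map-++ f xs ys)) (sum-++ (map f xs) (map f ys))

  ∑-cong : ∀ xs {f g : A → ℕ} → (∀ x → f x ≡ g x) → ∑[ x ∈ xs ] f x ≡ ∑[ x ∈ xs ] g x
  ∑-cong xs f≡g = cong sum (map-cong f≡g xs)

  ∑-cong-local : ∀ {xs} {f g : A → ℕ} → All (λ x → f x ≡ g x) xs → ∑[ x ∈ xs ] f x ≡ ∑[ x ∈ xs ] g x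
  ∑-cong-local f≡g = cong sum (map-cong-local f≡g)

  ∑-+ : ∀ xs (f g : A → ℕ) → ∑[ x ∈ xs ] (f x + g x) ≡ ∑[ x ∈ xs ] f x + ∑[ x ∈ xs ] g x
  ∑-+ []       f g = refl
  ∑-+ (x ∷ xs) f g = trans (cong (f x + g x +_) (∑-+ xs f g)) (interchange (f x) (g x) _ _)

  ∑-const : ∀ (xs : List A) c → ∑[ x ∈ xs ] c ≡ length xs * c
  ∑-const []       c = refl
  ∑-const (x ∷ xs) c = cong (c +_) (∑-const xs c)

∑-map : ∀ {A B : Set} (g : A → B) xs (f : B → ℕ) → ∑[ y ∈ map g xs ] f y ≡ ∑[ x ∈ xs ] f (g x)
∑-map g xs f = cong sum (sym (map-∘ xs))

∑-comm : ∀ {A B : Set} xs ys (f : A → B → ℕ) → ∑[ x ∈ xs ] ∑[ y ∈ ys ] f x y ≡ ∑[ y ∈ ys ] ∑[ x ∈ xs ] f x y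
∑-comm []       ys f = sym (trans (∑-const ys 0) (*-zeroʳ (length ys)))
∑-comm (x ∷ xs) ys f = trans (cong (∑[ y ∈ ys ] f x y +_) (∑-comm xs ys f))
                             (sym (∑-+ ys (f x) (λ y → ∑[ x ∈ xs ] f x y)))

∑-mono-≤ : ∀ {A : Set} {xs : List A} {f g : A → ℕ} → All (λ x → f x ≤ g x) xs →
           ∑[ x ∈ xs ] f x ≤ ∑[ x ∈ xs ] g x
∑-mono-≤ []         = z≤n
∑-mono-≤ (fx≤gx ∷ h) = +-mono-≤ fx≤gx (∑-mono-≤ h)

∑-↭ : ∀ {A : Set} {xs ys : List A} (f : A → ℕ) → xs ↭ ys → ∑[ x ∈ xs ] f x ≡ ∑[ x ∈ ys ] f x
∑-↭ f xs↭ys = sum-↭ (↭.map⁺ f xs↭ys)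

∑-indicator-< : ∀ k c → ∑[ v ∈ downFrom k ] indicator (v <ᵇ c) ≡ k ⊓ c
∑-indicator-< zero    c = refl
∑-indicator-< (suc k) c with k <? c
... | yes k<c rewrite <ᵇ≡true k<c =
  trans (cong suc (trans (∑-indicator-< k c) (m≤n⇒m⊓n≡m (<⇒≤ k<c)))) (sym (m≤n⇒m⊓n≡m k<c))
... | no  k≮c rewrite <ᵇ≡false (≮⇒≥ k≮c) =
  trans (∑-indicator-< k c) (trans (m≥n⇒m⊓n≡n (≮⇒≥ k≮c)) (sym (m≥n⇒m⊓n≡n (≤-trans (≮⇒≥ k≮c) (n≤1+n k)))))

∑-indicator-<-≤ : ∀ {k c} → c ≤ k → ∑[ v ∈ downFrom k ] indicator (v <ᵇ c) ≡ c
∑-indicator-<-≤ {k} {c} c≤k = trans (∑-indicator-< k c) (m≥n⇒m⊓n≡n c≤k)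

indicator-complement : ∀ ℓ v → indicator (ℓ <ᵇ v) + indicator (v <ᵇ suc ℓ) ≡ 1
indicator-complement zero    zero    = refl
indicator-complement zero    (suc v) = refl
indicator-complement (suc ℓ) zero    = refl
indicator-complement (suc ℓ) (suc v) = indicator-complement ℓ v

module _ {A : Set} where

  ∈-removeMiddle : ∀ {x z : A} ys₁ ys₂ → x ≢ z → z ∈ ys₁ ++ x ∷ ys₂ → z ∈ ys₁ ++ ys₂
  ∈-removeMiddle ys₁ ys₂ x≢z z∈ with ∈-++⁻ ys₁ z∈
  ... | inj₁ z∈₁          = ∈-++⁺ˡ z∈₁
  ... | inj₂ (here z≡x)   = ⊥-elim (x≢z (sym z≡x))
  ... | inj₂ (there z∈₂) = ∈-++⁺ʳ ys₁ z∈₂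

  Unique⇒length≤ : ∀ {xs ys : List A} → Unique xs → All (_∈ ys) xs → length xs ≤ length ys
  Unique⇒length≤ [] [] = z≤n
  Unique⇒length≤ {x ∷ xs} (x∉xs ∷ uxs) (x∈ys ∷ xs⊆ys) with ∈-∃++ x∈ys
  ... | ys₁ , ys₂ , refl =
    subst (suc (length xs) ≤_) (sym (length-++-sucʳ ys₁ x ys₂))
          (s≤s (Unique⇒length≤ uxs (All.zipWith (λ (x≢z , z∈) → ∈-removeMiddle ys₁ ys₂ x≢z z∈) (x∉xs , xs⊆ys))))

  length-∷ʳ : ∀ (xs : List A) x → length (xs ∷ʳ x) ≡ suc (length xs)
  length-∷ʳ xs x = trans (length-++ xs) (+-comm (length xs) 1)

  Unique-∷ʳ⁺ : ∀ {xs : List A} {y} → Unique xs → All (_≢ y) xs → Unique (xs ∷ʳ y)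
  Unique-∷ʳ⁺ []         []          = [] ∷ []
  Unique-∷ʳ⁺ (x∉ ∷ uxs) (x≢y ∷ xs≢y) = All.∷ʳ⁺ x∉ x≢y ∷ Unique-∷ʳ⁺ uxs xs≢y

  Unique-∷ʳ⁻ : ∀ {xs : List A} {y} → Unique (xs ∷ʳ y) → Unique xs × All (_≢ y) xs
  Unique-∷ʳ⁻ {[]}     _          = [] , []
  Unique-∷ʳ⁻ {x ∷ xs} (x∉ ∷ uxs) =
    let uxs′ , xs≢y = Unique-∷ʳ⁻ uxs
        x∉′ , x≢y   = All.∷ʳ⁻ x∉
    in  (x∉′ ∷ uxs′) , (x≢y ∷ xs≢y)

  Unique-++⁻ʳ : ∀ (xs : List A) {ys} → Unique (xs ++ ys) → Unique ys
  Unique-++⁻ʳ []       u         = u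
  Unique-++⁻ʳ (_ ∷ xs) (_ ∷ u) = Unique-++⁻ʳ xs u

fresh⇒All≢ : ∀ x ys → T (not (any (λ y → x ≡ᵇ y) ys)) → All (x ≢_) ys
fresh⇒All≢ x []       _ = []
fresh⇒All≢ x (y ∷ ys) h with x ≡ᵇ y in eq
... | false = (λ x≡y → subst T eq (≡⇒≡ᵇ x y x≡y)) ∷ fresh⇒All≢ x ys h

All≢⇒fresh : ∀ x ys → All (x ≢_) ys → T (not (any (λ y → x ≡ᵇ y) ys))
All≢⇒fresh x []       []         = tt
All≢⇒fresh x (y ∷ ys) (x≢y ∷ h) with x ≡ᵇ y in eq
... | true  = x≢y (≡ᵇ⇒≡ x y (subst T (sym eq) tt))
... | false = All≢⇒fresh x ys h

distinct⇒Unique : ∀ xs → T (distinct xs) → Unique xs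
distinct⇒Unique []       _ = []
distinct⇒Unique (x ∷ xs) h with Equivalence.to T-∧ h
... | fresh , rest = fresh⇒All≢ x xs fresh ∷ distinct⇒Unique xs rest

Unique⇒distinct : ∀ xs → Unique xs → T (distinct xs)
Unique⇒distinct []       _          = tt
Unique⇒distinct (x ∷ xs) (x∉ ∷ uxs) = Equivalence.from T-∧ (All≢⇒fresh x xs x∉ , Unique⇒distinct xs uxs)

∈-words⁺ : ∀ {n} k {w} → length w ≡ k → All (_< n) w → w ∈ words n k
∈-words⁺ zero    {[]}    refl []          = here refl
∈-words⁺ (suc k) {y ∷ w} refl (y<n ∷ w<n) =
  ∈-concatMap⁺ _ (Any.map (λ { refl → ∈-map⁺ (_∷ w) (∈-upTo⁺ y<n) }) (∈-words⁺ k refl w<n))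

∈-words⁻ : ∀ {n} k {w} → w ∈ words n k → length w ≡ k × All (_< n) w
∈-words⁻ zero    (here refl) = refl , []
∈-words⁻ {n} (suc k) w∈ with find (∈-concatMap⁻ (λ w → map (_∷ w) (upTo n)) {xs = words n k} w∈)
... | u , u∈ , w∈u with ∈-map⁻ (_∷ u) w∈u
... | y , y∈ , refl = let len , u<n = ∈-words⁻ k u∈ in cong suc len , ∈-upTo⁻ y∈ ∷ u<n

words-unique : ∀ n k → Unique (words n k)
words-unique n zero    = [] ∷ []
words-unique n (suc k) =
  Unique.concat⁺ (All.map⁺ (All.tabulate λ _ → Unique.map⁺ ∷-injectiveˡ (Unique.upTo⁺ n)))
                 (AllPairs.map⁺ (AllPairs.map disjoint (words-unique n k)))
  where
  disjoint : ∀ {u u′} → u ≢ u′ → ∀ {w} → w ∈ map (_∷ u) (upTo n) × w ∈ map (_∷ u′) (upTo n) → ⊥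
  disjoint u≢u′ (w∈ , w∈′) with ∈-map⁻ _ w∈ | ∈-map⁻ _ w∈′
  ... | _ , _ , refl | _ , _ , refl = u≢u′ refl

record IsPermutation (n : ℕ) (π : List ℕ) : Set where
  constructor mkPerm
  field
    length≡  : length π ≡ n
    entries< : All (_< n) π
    unique   : Unique π

∈-perms⁺ : ∀ {n π} → IsPermutation n π → π ∈ perms n
∈-perms⁺ {n} {π} (mkPerm len π<n uπ) = ∈-filter⁺ (λ w → T? (distinct w)) (∈-words⁺ n len π<n) (Unique⇒distinct π uπ)

∈-perms⁻ : ∀ {n π} → π ∈ perms n → IsPermutation n π
∈-perms⁻ {n} {π} π∈ with ∈-filter⁻ (λ w → T? (distinct w)) {xs = words n n} π∈
... | π∈words , dπ = let len , π<n = ∈-words⁻ n π∈words in mkPerm len π<n (distinct⇒Unique π dπ)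

perms-unique : ∀ n → Unique (perms n)
perms-unique n = Unique.filter⁺ (λ w → T? (distinct w)) (words-unique n n)

0∈perm : ∀ {n π} → IsPermutation (suc n) π → 0 ∈ π
0∈perm {n} {π} (mkPerm len π<n uπ) with 0 ∈? π
... | yes 0∈π = 0∈π
... | no  0∉π = ⊥-elim (<-irrefl refl (begin
  suc n                          ≡⟨ sym len ⟩
  length π                       ≤⟨ Unique⇒length≤ uπ (All.tabulate positive) ⟩
  length (map suc (downFrom n))  ≡⟨ trans (length-map suc (downFrom n)) (length-downFrom n) ⟩
  n                              ∎))
  where
  open ≤-Reasoning
  positive : ∀ {z} → z ∈ π → z ∈ map suc (downFrom n)
  positive {zero}  z∈ = ⊥-elim (0∉π z∈)
  positive {suc z} z∈ = ∈-map⁺ suc (∈-downFrom⁺ (s≤s⁻¹ (All.lookup π<n z∈)))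

-- Generating the avoiders of 123 and 132

appendMin : List ℕ → List ℕ
appendMin σ = map suc σ ∷ʳ 0

appendMinThen : ℕ → List ℕ → List ℕ
appendMinThen v σ = appendMin (map (punchIn v) σ) ∷ʳ suc v

extensions : List (List ℕ) → ℕ → List (List ℕ)
extensions L zero    = []
extensions L (suc k) = map (appendMinThen k) L ++ extensions L k

avoiders : ℕ → List (List ℕ)
avoiders zero          = [] ∷ []
avoiders (suc zero)    = (0 ∷ []) ∷ []
avoiders (suc (suc n)) = map appendMin (avoiders (suc n)) ++ extensions (avoiders n) (suc n)

∈-extensions⁺ : ∀ L {k v σ} → v < k → σ ∈ L → appendMinThen v σ ∈ extensions L k
∈-extensions⁺ L {suc k} {v} v<1+k σ∈ with v ≟ k
... | yes refl = ∈-++⁺ˡ (∈-map⁺ (appendMinThen v) σ∈)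
... | no  v≢k  = ∈-++⁺ʳ (map (appendMinThen k) L) (∈-extensions⁺ L (≤∧≢⇒< (s≤s⁻¹ v<1+k) v≢k) σ∈)

∈-extensions⁻ : ∀ L k {π} → π ∈ extensions L k → ∃[ v ] ∃[ σ ] v < k × σ ∈ L × π ≡ appendMinThen v σ
∈-extensions⁻ L (suc k) π∈ with ∈-++⁻ (map (appendMinThen k) L) π∈
... | inj₁ π∈₁ = let σ , σ∈ , π≡ = ∈-map⁻ (appendMinThen k) π∈₁ in k , σ , ≤-refl , σ∈ , π≡
... | inj₂ π∈₂ = let v , σ , v<k , σ∈ , π≡ = ∈-extensions⁻ L k π∈₂ in v , σ , m<n⇒m<1+n v<k , σ∈ , π≡

total : (List ℕ → ℕ) → ℕ → ℕ
total f n = ∑[ σ ∈ avoiders n ] f σ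

∑-extensions : ∀ L k (f : List ℕ → ℕ) →
               ∑[ π ∈ extensions L k ] f π ≡ ∑[ v ∈ downFrom k ] ∑[ σ ∈ L ] f (appendMinThen v σ)
∑-extensions L zero    f = refl
∑-extensions L (suc k) f = trans (∑-++ (map (appendMinThen k) L) (extensions L k) f)
                                 (cong₂ _+_ (∑-map (appendMinThen k) L f) (∑-extensions L k f))

total-step : ∀ f n → total f (suc (suc n)) ≡ ∑[ σ ∈ avoiders (suc n) ] f (appendMin σ)
                                              + ∑[ v ∈ downFrom (suc n) ] ∑[ σ ∈ avoiders n ] f (appendMinThen v σ)
total-step f n = trans (∑-++ (map appendMin (avoiders (suc n))) (extensions (avoiders n) (suc n)) f)
                       (cong₂ _+_ (∑-map appendMin (avoiders (suc n)) f) (∑-extensions (avoiders n) (suc n) f))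

module Pattern (x y z : ℕ) (occurs-ending0 : ∀ a b → occurs (x ∷ y ∷ z ∷ []) a b 0 ≡ 0) where

  occurrences : List ℕ → ℕ
  occurrences = windowSum (occurs (x ∷ y ∷ z ∷ []))

  occurrences-embedding-∷ʳ0 : ∀ {s} → OrderEmbedding s → ∀ σ → occurrences (map s σ ∷ʳ 0) ≡ occurrences σ
  occurrences-embedding-∷ʳ0 {s} emb σ = begin
    occurrences (map s σ ∷ʳ 0)
      ≡⟨ windowSum-∷ʳ _ (map s σ) 0 ⟩
    occurrences (map s σ) + lastWindow (occurs (x ∷ y ∷ z ∷ [])) (map s σ) 0
      ≡⟨ cong₂ _+_ (windowSum-embedding {s} emb x y z σ) (lastWindow-zero occurs-ending0 (map s σ)) ⟩
    occurrences σ + 0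
      ≡⟨ +-identityʳ _ ⟩
    occurrences σ
      ∎
    where open ≡-Reasoning

  occurrences-appendMin : ∀ σ → occurrences (appendMin σ) ≡ occurrences σ
  occurrences-appendMin = occurrences-embedding-∷ʳ0 suc-embedding

  newWindow : ℕ → List ℕ → ℕ
  newWindow v σ = lastWindow (occurs (x ∷ y ∷ z ∷ [])) (appendMin (map (punchIn v) σ)) (suc v)

  occurrences-appendMinThen : ∀ v σ → occurrences (appendMinThen v σ) ≡ occurrences σ + newWindow v σ
  occurrences-appendMinThen v σ = begin
    occurrences (τ ∷ʳ suc v)                                       ≡⟨ windowSum-∷ʳ _ τ (suc v) ⟩
    occurrences τ + newWindow v σ                                  ≡⟨ cong (_+ newWindow v σ) (begin
      occurrences (appendMin (map (punchIn v) σ))                    ≡⟨ occurrences-appendMin (map (punchIn v) σ) ⟩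
      occurrences (map (punchIn v) σ)                                ≡⟨ windowSum-embedding (punchIn-embedding v) x y z σ ⟩
      occurrences σ                                                  ∎) ⟩
    occurrences σ + newWindow v σ                                  ∎
    where
    open ≡-Reasoning
    τ = appendMin (map (punchIn v) σ)

  total-occurrences-step : ∀ n → total occurrences (2 + n)
    ≡ total occurrences (1 + n) + (1 + n) * total occurrences n + ∑[ σ ∈ avoiders n ] ∑[ v ∈ downFrom (1 + n) ] newWindow v σ
  total-occurrences-step n = begin
    total occurrences (2 + n)
      ≡⟨ total-step occurrences n ⟩
    ∑[ σ ∈ avoiders (1 + n) ] occurrences (appendMin σ) + ∑[ v ∈ vs ] ∑[ σ ∈ avoiders n ] occurrences (appendMinThen v σ)
      ≡⟨ cong₂ _+_ (∑-cong (avoiders (1 + n)) occurrences-appendMin)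
                   (∑-cong vs (λ v → ∑-cong (avoiders n) (occurrences-appendMinThen v))) ⟩
    total occurrences (1 + n) + ∑[ v ∈ vs ] ∑[ σ ∈ avoiders n ] (occurrences σ + newWindow v σ)
      ≡⟨ cong (total occurrences (1 + n) +_)
              (trans (∑-cong vs (λ v → ∑-+ (avoiders n) occurrences (newWindow v)))
                     (∑-+ vs (λ _ → total occurrences n) (λ v → ∑[ σ ∈ avoiders n ] newWindow v σ))) ⟩
    total occurrences (1 + n) + (∑[ v ∈ vs ] total occurrences n + ∑[ v ∈ vs ] ∑[ σ ∈ avoiders n ] newWindow v σ)
      ≡⟨ cong (total occurrences (1 + n) +_)
              (cong₂ _+_ (trans (∑-const vs (total occurrences n)) (cong (_* total occurrences n) (length-downFrom (1 + n))))
                         (∑-comm vs (avoiders n) newWindow)) ⟩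
    total occurrences (1 + n) + ((1 + n) * total occurrences n + ∑[ σ ∈ avoiders n ] ∑[ v ∈ vs ] newWindow v σ)
      ≡⟨ sym (+-assoc (total occurrences (1 + n)) _ _) ⟩
    total occurrences (1 + n) + (1 + n) * total occurrences n + ∑[ σ ∈ avoiders n ] ∑[ v ∈ vs ] newWindow v σ
      ∎
    where
    open ≡-Reasoning
    vs = downFrom (1 + n)

module P123 = Pattern 1 2 3 (λ a b → proj₁ (occurs-endingAt0 a b))
module P132 = Pattern 1 3 2 (λ a b → proj₁ (proj₂ (occurs-endingAt0 a b)))
module P312 = Pattern 3 1 2 (λ a b → proj₁ (proj₂ (proj₂ (occurs-endingAt0 a b))))
module P213 = Pattern 2 1 3 (λ a b → proj₂ (proj₂ (proj₂ (occurs-endingAt0 a b))))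

Avoids : List ℕ → Set
Avoids π = P123.occurrences π ≡ 0 × P132.occurrences π ≡ 0

avoidsAll⇒Avoids : ∀ π → T (avoidsAll (p123 ∷ p132 ∷ []) π) → Avoids π
avoidsAll⇒Avoids π h with Equivalence.to T-∧ h
... | occ₁≡0 , rest with Equivalence.to T-∧ rest
... | occ₂≡0 , _ = trans (sym (occ≡windowSum 1 2 3 π)) (≡ᵇ⇒≡ _ 0 occ₁≡0)
                 , trans (sym (occ≡windowSum 1 3 2 π)) (≡ᵇ⇒≡ _ 0 occ₂≡0)

Avoids⇒avoidsAll : ∀ π → Avoids π → T (avoidsAll (p123 ∷ p132 ∷ []) π)
Avoids⇒avoidsAll π (w₁ , w₂) = Equivalence.from T-∧
  ( ≡⇒≡ᵇ _ 0 (trans (occ≡windowSum 1 2 3 π) w₁)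
  , Equivalence.from T-∧ (≡⇒≡ᵇ _ 0 (trans (occ≡windowSum 1 3 2 π) w₂) , tt))

Avoids-∷ʳ⁻ : ∀ π {c} → Avoids (π ∷ʳ c) → Avoids π
Avoids-∷ʳ⁻ π {c} (w₁ , w₂) = m+n≡0⇒m≡0 _ (trans (sym (windowSum-∷ʳ _ π c)) w₁)
                         , m+n≡0⇒m≡0 _ (trans (sym (windowSum-∷ʳ _ π c)) w₂)

Avoids-map⁻ : ∀ {s} → OrderEmbedding s → ∀ σ → Avoids (map s σ) → Avoids σ
Avoids-map⁻ {s} emb σ (w₁ , w₂) = trans (sym (windowSum-embedding {s} emb 1 2 3 σ)) w₁
                                , trans (sym (windowSum-embedding {s} emb 1 3 2 σ)) w₂

Avoids-appendMin : ∀ {σ} → Avoids σ → Avoids (appendMin σ)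
Avoids-appendMin {σ} (w₁ , w₂) = trans (P123.occurrences-appendMin σ) w₁ , trans (P132.occurrences-appendMin σ) w₂

Avoids-appendMinThen : ∀ {v σ} → Avoids σ → Avoids (appendMinThen v σ)
Avoids-appendMinThen {v} {σ} (w₁ , w₂) =
  trans (P123.occurrences-appendMinThen v σ) (cong₂ _+_ w₁ (lastWindow-∷ʳ0 {occurs p123} (λ _ _ → refl) τ (suc v))) ,
  trans (P132.occurrences-appendMinThen v σ) (cong₂ _+_ w₂ (lastWindow-∷ʳ0 {occurs p132} (λ _ _ → refl) τ (suc v)))
  where τ = map suc (map (punchIn v) σ)

IsPermutation-appendMin : ∀ {n σ} → IsPermutation (suc n) σ → IsPermutation (suc (suc n)) (appendMin σ)
IsPermutation-appendMin {σ = σ} (mkPerm len σ< uσ) = mkPerm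
  (trans (length-∷ʳ (map suc σ) 0) (cong suc (trans (length-map suc σ) len)))
  (All.∷ʳ⁺ (All.map⁺ (All.map s≤s σ<)) z<s)
  (Unique-∷ʳ⁺ (Unique.map⁺ suc-injective uσ) (All.map⁺ (All.universal (λ _ ()) σ)))

IsPermutation-appendMinThen : ∀ {n v σ} → v < suc n → IsPermutation n σ →
                              IsPermutation (suc (suc n)) (appendMinThen v σ)
IsPermutation-appendMinThen {v = v} {σ} v<1+n (mkPerm len σ< uσ) = mkPerm
  (trans (length-∷ʳ (τ ∷ʳ 0) (suc v))
         (cong suc (trans (length-∷ʳ τ 0)
                          (cong suc (trans (length-map suc (map (punchIn v) σ)) (trans (length-map (punchIn v) σ) len))))))
  (All.∷ʳ⁺ (All.∷ʳ⁺ (All.map⁺ (All.map⁺ (All.map (s≤s ∘ punchIn-< v) σ<))) z<s) (s≤s v<1+n))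
  (Unique-∷ʳ⁺ (Unique-∷ʳ⁺ (Unique.map⁺ suc-injective (Unique.map⁺ (punchIn-injective v) uσ))
                          (All.map⁺ (All.universal (λ _ ()) _)))
              (All.∷ʳ⁺ (All.map⁺ (All.map⁺ (All.universal (λ y → punchIn≢ v y ∘ suc-injective) σ))) (λ ())))
  where τ = map suc (map (punchIn v) σ)

avoiders-sound : ∀ n → All (λ π → IsPermutation n π × Avoids π) (avoiders n)
avoiders-sound zero          = (mkPerm refl [] [] , refl , refl) ∷ []
avoiders-sound (suc zero)    = (mkPerm refl (z<s ∷ []) ([] ∷ []) , refl , refl) ∷ []
avoiders-sound (suc (suc n)) =
  All.++⁺ (All.map⁺ (All.map (λ {σ} (perm , av) → IsPermutation-appendMin perm , Avoids-appendMin {σ} av)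
                             (avoiders-sound (suc n))))
          (extensions-sound (suc n) ≤-refl)
  where
  extensions-sound : ∀ k → k ≤ suc n → All (λ π → IsPermutation (suc (suc n)) π × Avoids π) (extensions (avoiders n) k)
  extensions-sound zero    _     = []
  extensions-sound (suc k) 1+k≤ =
    All.++⁺ (All.map⁺ (All.map (λ {σ} (perm , av) → IsPermutation-appendMinThen 1+k≤ perm , Avoids-appendMinThen {k} {σ} av)
                               (avoiders-sound n)))
            (extensions-sound k (≤-trans (n≤1+n k) 1+k≤))

appendMin-surjective : ∀ {n a} → IsPermutation (suc (suc n)) (a ∷ʳ 0) → Avoids (a ∷ʳ 0) →
                       ∃[ σ ] IsPermutation (suc n) σ × Avoids σ × appendMin σ ≡ a ∷ʳ 0
appendMin-surjective {n} {a} (mkPerm len a0< ua0) av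
  with Unique-∷ʳ⁻ ua0 | All.∷ʳ⁻ a0<
... | ua , a≢0 | a< , _ with punchOut-inverse z≤n a< a≢0
... | σ< , map-suc-σ≡a =
  σ , mkPerm (trans (length-map _ a) (suc-injective (trans (sym (length-∷ʳ a 0)) len)))
             σ<
             (Unique.map⁻ (subst Unique (sym map-suc-σ≡a) ua))
    , Avoids-map⁻ suc-embedding σ (subst Avoids (sym map-suc-σ≡a) (Avoids-∷ʳ⁻ a av))
    , cong (_∷ʳ 0) map-suc-σ≡a
  where σ = map (punchOut 0) a

appendMinThen-surjective : ∀ {n a y} → IsPermutation (suc (suc n)) (a ∷ʳ 0 ∷ʳ y) → Avoids (a ∷ʳ 0 ∷ʳ y) →
                           ∃[ v ] ∃[ σ ] v < suc n × IsPermutation n σ × Avoids σ × appendMinThen v σ ≡ a ∷ʳ 0 ∷ʳ y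
appendMinThen-surjective {y = zero} (mkPerm _ _ ua0y) _ = ⊥-elim (proj₂ (All.∷ʳ⁻ (proj₂ (Unique-∷ʳ⁻ ua0y))) refl)
appendMinThen-surjective {n} {a} {suc v} (mkPerm len a0y< ua0y) av
  with Unique-∷ʳ⁻ ua0y | All.∷ʳ⁻ a0y<
... | ua0 , a0≢1+v | a0< , 1+v< with Unique-∷ʳ⁻ ua0 | All.∷ʳ⁻ a0< | All.∷ʳ⁻ a0≢1+v
... | ua , a≢0 | a< , _ | a≢1+v , _ with punchOut-inverse z≤n a< a≢0
... | τ< , map-suc-τ≡a
  with punchOut-inverse (s≤s⁻¹ (s≤s⁻¹ 1+v<)) τ<
         (All.map⁺ (All.zipWith (λ (z≢0 , z≢1+v) → punchOut≢ z≢0 z≢1+v) (a≢0 , a≢1+v)))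
... | σ< , map-punchIn-σ≡τ =
  v , σ , s≤s⁻¹ 1+v<
    , mkPerm (trans (length-map _ τ) (trans (length-map _ a) (suc-injective (suc-injective (trans (sym length-a0y) len)))))
             σ<
             (Unique.map⁻ (Unique.map⁻ (subst Unique (sym a≡) ua)))
    , Avoids-map⁻ (punchIn-embedding v) σ (Avoids-map⁻ suc-embedding (map (punchIn v) σ)
                                             (subst Avoids (sym a≡) (Avoids-∷ʳ⁻ a (Avoids-∷ʳ⁻ (a ∷ʳ 0) av))))
    , cong (λ ρ → ρ ∷ʳ 0 ∷ʳ suc v) a≡
  where
  τ = map (punchOut 0) a
  σ = map (punchOut v) τ
  a≡ : map suc (map (punchIn v) σ) ≡ a
  a≡ = trans (cong (map suc) map-punchIn-σ≡τ) map-suc-τ≡a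
  length-a0y : length (a ∷ʳ 0 ∷ʳ suc v) ≡ suc (suc (length a))
  length-a0y = trans (length-∷ʳ (a ∷ʳ 0) (suc v)) (cong suc (length-∷ʳ a 0))

¬Avoids-0-early : ∀ π y z ρ → Unique (π ++ 0 ∷ y ∷ z ∷ ρ) → ¬ Avoids (π ++ 0 ∷ y ∷ z ∷ ρ)
¬Avoids-0-early π y z ρ u av with Unique-++⁻ʳ π u
¬Avoids-0-early π zero    _       ρ u av        | (0≢0 ∷ _) ∷ _     = 0≢0 refl
¬Avoids-0-early π (suc y) zero    ρ u av        | (_ ∷ 0≢0 ∷ _) ∷ _ = 0≢0 refl
¬Avoids-0-early π (suc y) (suc z) ρ u (w₁ , w₂) | _ ∷ (y≢z ∷ _) ∷ _ = n≮0 (begin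
  1                                                              ≤⟨ occurs-startingAt0 y z (y≢z ∘ cong suc) ⟩
  occurs p123 0 (suc y) (suc z) + occurs p132 0 (suc y) (suc z)  ≤⟨ +-mono-≤ (windowSum-window _ π 0 _ _ ρ)
                                                                              (windowSum-window _ π 0 _ _ ρ) ⟩
  P123.occurrences π′ + P132.occurrences π′                      ≡⟨ cong₂ _+_ w₁ w₂ ⟩
  0                                                              ∎)
  where
  open ≤-Reasoning
  π′ = π ++ 0 ∷ suc y ∷ suc z ∷ ρ

avoiders-complete-step : ∀ {n π} →
  (∀ {σ} → IsPermutation (suc n) σ → Avoids σ → σ ∈ avoiders (suc n)) →
  (∀ {σ} → IsPermutation n σ → Avoids σ → σ ∈ avoiders n) →
  IsPermutation (suc (suc n)) π → Avoids π → π ∈ avoiders (suc (suc n))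
avoiders-complete-step {n} complete₁ complete₀ perm av with ∈-∃++ (0∈perm perm)
... | a , [] , refl =
  let σ , permσ , avσ , σ↦π = appendMin-surjective perm av
  in  subst (_∈ avoiders (suc (suc n))) σ↦π (∈-++⁺ˡ (∈-map⁺ appendMin (complete₁ permσ avσ)))
... | a , y ∷ [] , refl =
  let v , σ , v<1+n , permσ , avσ , σ↦π = appendMinThen-surjective (subst (IsPermutation _) assoc perm) (subst Avoids assoc av)
  in  subst (_∈ avoiders (suc (suc n))) (trans σ↦π (sym assoc))
            (∈-++⁺ʳ (map appendMin (avoiders (suc n))) (∈-extensions⁺ (avoiders n) v<1+n (complete₀ permσ avσ)))
  where
  assoc : a ++ 0 ∷ y ∷ [] ≡ a ∷ʳ 0 ∷ʳ y
  assoc = sym (++-assoc a (0 ∷ []) (y ∷ []))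
... | a , y ∷ z ∷ ρ , refl = ⊥-elim (¬Avoids-0-early a y z ρ (IsPermutation.unique perm) av)

avoiders-complete : ∀ n {π} → IsPermutation n π → Avoids π → π ∈ avoiders n
avoiders-complete zero          {[]}          _ _ = here refl
avoiders-complete zero          {_ ∷ _}       (mkPerm () _ _) _
avoiders-complete (suc zero)    {[]}          (mkPerm () _ _) _
avoiders-complete (suc zero)    {zero ∷ []}   _ _ = here refl
avoiders-complete (suc zero)    {suc _ ∷ []}  (mkPerm _ (s≤s () ∷ []) _) _
avoiders-complete (suc zero)    {_ ∷ _ ∷ _}   (mkPerm () _ _) _
avoiders-complete (suc (suc n)) = avoiders-complete-step (avoiders-complete (suc n)) (avoiders-complete n)

appendMin-injective : ∀ {σ τ} → appendMin σ ≡ appendMin τ → σ ≡ τ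
appendMin-injective eq = map-injective suc-injective (∷ʳ-injectiveˡ _ _ eq)

appendMinThen-injective : ∀ v {σ τ} → appendMinThen v σ ≡ appendMinThen v τ → σ ≡ τ
appendMinThen-injective v eq = map-injective (punchIn-injective v) (appendMin-injective (∷ʳ-injectiveˡ _ _ eq))

extensions-unique : ∀ {L} k → Unique L → Unique (extensions L k)
extensions-unique zero    uL = []
extensions-unique {L} (suc k) uL = Unique.++⁺ (Unique.map⁺ (appendMinThen-injective k) uL) (extensions-unique k uL) disjoint
  where
  disjoint : ∀ {π} → ¬ (π ∈ map (appendMinThen k) L × π ∈ extensions L k)
  disjoint (π∈₁ , π∈₂) with ∈-map⁻ (appendMinThen k) π∈₁ | ∈-extensions⁻ L k π∈₂
  ... | σ , _ , refl | v , τ , v<k , _ , eq = <-irrefl (sym (suc-injective (∷ʳ-injectiveʳ _ _ eq))) v<k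

avoiders-unique : ∀ n → Unique (avoiders n)
avoiders-unique zero          = [] ∷ []
avoiders-unique (suc zero)    = [] ∷ []
avoiders-unique (suc (suc n)) =
  Unique.++⁺ (Unique.map⁺ appendMin-injective (avoiders-unique (suc n))) (extensions-unique (suc n) (avoiders-unique n)) disjoint
  where
  disjoint : ∀ {π} → ¬ (π ∈ map appendMin (avoiders (suc n)) × π ∈ extensions (avoiders n) (suc n))
  disjoint (π∈₁ , π∈₂) with ∈-map⁻ appendMin π∈₁ | ∈-extensions⁻ (avoiders n) (suc n) π∈₂
  ... | σ , _ , refl | v , τ , _ , _ , eq with ∷ʳ-injectiveʳ _ _ eq
  ... | ()

Av↭avoiders : ∀ n → Av (p123 ∷ p132 ∷ []) n ↭ avoiders n
Av↭avoiders n = ∼bag⇒↭ (unique∧set⇒bag (Unique.filter⁺ avoids? (perms-unique n)) (avoiders-unique n) (mk⇔ to from))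
  where
  avoids? : ∀ π → Dec (T (avoidsAll (p123 ∷ p132 ∷ []) π))
  avoids? π = T? (avoidsAll (p123 ∷ p132 ∷ []) π)
  to : ∀ {π} → π ∈ Av (p123 ∷ p132 ∷ []) n → π ∈ avoiders n
  to {π} π∈ = let π∈perms , avoids = ∈-filter⁻ avoids? {xs = perms n} π∈
              in avoiders-complete n (∈-perms⁻ π∈perms) (avoidsAll⇒Avoids π avoids)
  from : ∀ {π} → π ∈ avoiders n → π ∈ Av (p123 ∷ p132 ∷ []) n
  from {π} π∈ = let perm , av = All.lookup (avoiders-sound n) π∈
                in ∈-filter⁺ avoids? (∈-perms⁺ perm) (Avoids⇒avoidsAll π av)

-- Counting, and the recurrences for the totals

involutions : ℕ → ℕ
involutions zero          = 1
involutions (suc zero)    = 1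
involutions (suc (suc n)) = involutions (suc n) + suc n * involutions n

involutions-mono : ∀ n → involutions n ≤ involutions (suc n)
involutions-mono zero    = ≤-refl
involutions-mono (suc n) = m≤m+n _ _

involutions-pos : ∀ n → 1 ≤ involutions n
involutions-pos zero          = ≤-refl
involutions-pos (suc zero)    = ≤-refl
involutions-pos (suc (suc n)) = ≤-trans (involutions-pos (suc n)) (m≤m+n _ _)

length-extensions : ∀ L k → length (extensions L k) ≡ k * length L
length-extensions L zero    = refl
length-extensions L (suc k) = trans (length-++ (map (appendMinThen k) L))
                                    (cong₂ _+_ (length-map _ L) (length-extensions L k))

length-avoiders : ∀ n → length (avoiders n) ≡ involutions n
length-avoiders zero          = refl
length-avoiders (suc zero)    = refl
length-avoiders (suc (suc n)) =
  trans (length-++ (map appendMin (avoiders (suc n))))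
        (cong₂ _+_ (trans (length-map _ (avoiders (suc n))) (length-avoiders (suc n)))
                   (trans (length-extensions (avoiders n) (suc n)) (cong (suc n *_) (length-avoiders n))))

length-Av : ∀ n → length (Av (p123 ∷ p132 ∷ []) n) ≡ involutions n
length-Av n = trans (↭.↭-length (Av↭avoiders n)) (length-avoiders n)

totalOcc≡total : ∀ x y z n →
                 totalOcc (p123 ∷ p132 ∷ []) (x ∷ y ∷ z ∷ []) n ≡ total (windowSum (occurs (x ∷ y ∷ z ∷ []))) n
totalOcc≡total x y z n = trans (∑-↭ (occ (x ∷ y ∷ z ∷ [])) (Av↭avoiders n)) (∑-cong (avoiders n) (occ≡windowSum x y z))

lastSum : ℕ → ℕ
lastSum = total (suc ∘ lastEntry)

lastWindow-appendMin : ∀ g v a π → lastWindow g (appendMin (map (punchIn v) (a ∷ π))) (suc v)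
                                   ≡ g (suc (punchIn v (lastEntry (a ∷ π)))) 0 (suc v)
lastWindow-appendMin g v a π =
  trans (lastWindow-∷ʳ g _ (map suc (map (punchIn v) π)) 0 (suc v))
        (cong (λ e → g e 0 (suc v))
              (trans (lastEntry-map suc (punchIn v a) (map (punchIn v) π)) (cong suc (lastEntry-map (punchIn v) a π))))

∑-newWindow-312 : ∀ {m σ} → IsPermutation (suc m) σ → ∑[ v ∈ downFrom (2 + m) ] P312.newWindow v σ ≡ suc (lastEntry σ)
∑-newWindow-312 {m} {a ∷ π} (mkPerm _ σ< _) =
  trans (∑-cong (downFrom (2 + m)) (λ v → trans (lastWindow-appendMin (occurs p312) v a π)
                                           (trans (occurs-312-through0 (punchIn v ℓ) v) (cong indicator (<ᵇ-punchIn v ℓ)))))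
        (∑-indicator-<-≤ (s≤s (<⇒≤ (All.lookup σ< (lastEntry-∈ a π)))))
  where ℓ = lastEntry (a ∷ π)

∑-newWindow-213 : ∀ {m σ} → IsPermutation (suc m) σ →
                  ∑[ v ∈ downFrom (2 + m) ] P213.newWindow v σ + suc (lastEntry σ) ≡ 2 + m
∑-newWindow-213 {m} {a ∷ π} (mkPerm _ σ< _) = begin
  ∑[ v ∈ vs ] P213.newWindow v (a ∷ π) + suc ℓ
    ≡⟨ cong₂ _+_ (∑-cong vs (λ v → trans (lastWindow-appendMin (occurs p213) v a π)
                                         (trans (occurs-213-through0 (punchIn v ℓ) v) (cong indicator (punchIn-<ᵇ v ℓ)))))
                 (sym (∑-indicator-<-≤ (s≤s (<⇒≤ (All.lookup σ< (lastEntry-∈ a π)))))) ⟩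
  ∑[ v ∈ vs ] indicator (ℓ <ᵇ v) + ∑[ v ∈ vs ] indicator (v <ᵇ suc ℓ)
    ≡⟨ sym (∑-+ vs (λ v → indicator (ℓ <ᵇ v)) (λ v → indicator (v <ᵇ suc ℓ))) ⟩
  ∑[ v ∈ vs ] (indicator (ℓ <ᵇ v) + indicator (v <ᵇ suc ℓ))
    ≡⟨ ∑-cong vs (indicator-complement ℓ) ⟩
  ∑[ v ∈ vs ] 1
    ≡⟨ trans (∑-const vs 1) (trans (*-identityʳ _) (length-downFrom (2 + m))) ⟩
  2 + m
    ∎
  where
  open ≡-Reasoning
  ℓ = lastEntry (a ∷ π)
  vs = downFrom (2 + m)

total-312-rec : ∀ m → total P312.occurrences (3 + m)
                     ≡ total P312.occurrences (2 + m) + (2 + m) * total P312.occurrences (1 + m) + lastSum (1 + m)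
total-312-rec m = trans (P312.total-occurrences-step (1 + m))
  (cong (total P312.occurrences (2 + m) + (2 + m) * total P312.occurrences (1 + m) +_)
        (∑-cong-local (All.map (∑-newWindow-312 ∘ proj₁) (avoiders-sound (1 + m)))))

total-213-rec : ∀ m → total P213.occurrences (3 + m) + lastSum (1 + m)
                     ≡ total P213.occurrences (2 + m) + (2 + m) * total P213.occurrences (1 + m) + (2 + m) * involutions (1 + m)
total-213-rec m = begin
  S (3 + m) + lastSum (1 + m)
    ≡⟨ cong (_+ lastSum (1 + m)) (P213.total-occurrences-step (1 + m)) ⟩
  S (2 + m) + (2 + m) * S (1 + m) + ∑[ σ ∈ A ] W σ + lastSum (1 + m)
    ≡⟨ +-assoc (S (2 + m) + (2 + m) * S (1 + m)) _ _ ⟩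
  S (2 + m) + (2 + m) * S (1 + m) + (∑[ σ ∈ A ] W σ + lastSum (1 + m))
    ≡⟨ cong (S (2 + m) + (2 + m) * S (1 + m) +_) (begin
         ∑[ σ ∈ A ] W σ + ∑[ σ ∈ A ] suc (lastEntry σ) ≡⟨ sym (∑-+ A W (suc ∘ lastEntry)) ⟩
         ∑[ σ ∈ A ] (W σ + suc (lastEntry σ))          ≡⟨ ∑-cong-local (All.map (∑-newWindow-213 ∘ proj₁)
                                                                                (avoiders-sound (1 + m))) ⟩
         ∑[ σ ∈ A ] (2 + m)                            ≡⟨ ∑-const A (2 + m) ⟩
         length A * (2 + m)                            ≡⟨ cong (_* (2 + m)) (length-avoiders (1 + m)) ⟩
         involutions (1 + m) * (2 + m)                 ≡⟨ *-comm (involutions (1 + m)) (2 + m) ⟩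
         (2 + m) * involutions (1 + m)                 ∎) ⟩
  S (2 + m) + (2 + m) * S (1 + m) + (2 + m) * involutions (1 + m)
    ∎
  where
  open ≡-Reasoning
  S = total P213.occurrences
  A = avoiders (1 + m)
  W = λ σ → ∑[ v ∈ downFrom (2 + m) ] P213.newWindow v σ

lastSum-step : ∀ m → lastSum (2 + m) ≡ involutions (1 + m) + involutions m * ∑[ v ∈ downFrom (1 + m) ] (2 + v)
lastSum-step m = begin
  lastSum (2 + m)
    ≡⟨ total-step (suc ∘ lastEntry) m ⟩
  ∑[ σ ∈ avoiders (1 + m) ] suc (lastEntry (appendMin σ))
    + ∑[ v ∈ vs ] ∑[ σ ∈ avoiders m ] suc (lastEntry (appendMinThen v σ))
    ≡⟨ cong₂ _+_ (∑-cong (avoiders (1 + m)) (λ σ → cong suc (lastEntry-∷ʳ (map suc σ) 0)))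
                 (∑-cong vs (λ v → ∑-cong (avoiders m) (λ σ → cong suc (lastEntry-∷ʳ (appendMin (map (punchIn v) σ)) (suc v))))) ⟩
  ∑[ σ ∈ avoiders (1 + m) ] 1 + ∑[ v ∈ vs ] ∑[ σ ∈ avoiders m ] (2 + v)
    ≡⟨ cong₂ _+_ (trans (∑-const (avoiders (1 + m)) 1) (trans (*-identityʳ _) (length-avoiders (1 + m))))
                 (trans (∑-comm vs (avoiders m) (λ v _ → 2 + v))
                        (trans (∑-const (avoiders m) W) (cong (_* W) (length-avoiders m)))) ⟩
  involutions (1 + m) + involutions m * W ∎
  where
  open ≡-Reasoning
  vs = downFrom (1 + m)
  W  = ∑[ v ∈ vs ] (2 + v)

2*∑-2+ : ∀ k → 2 * ∑[ v ∈ downFrom k ] (2 + v) ≡ k * (k + 3)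
2*∑-2+ zero    = refl
2*∑-2+ (suc k) = begin
  2 * (2 + k + W)         ≡⟨ *-distribˡ-+ 2 (2 + k) W ⟩
  2 * (2 + k) + 2 * W     ≡⟨ cong (2 * (2 + k) +_) (2*∑-2+ k) ⟩
  2 * (2 + k) + k * (k + 3) ≡⟨ gauss k ⟩
  suc k * (suc k + 3)     ∎
  where
  open ≡-Reasoning
  W = ∑[ v ∈ downFrom k ] (2 + v)
  gauss : ∀ k → 2 * (2 + k) + k * (k + 3) ≡ suc k * (suc k + 3)
  gauss = solve-∀

2*lastSum : ∀ m → 2 * lastSum (2 + m) ≡ 2 * involutions (1 + m) + involutions m * ((1 + m) * (1 + m + 3))
2*lastSum m = begin
  2 * lastSum (2 + m)                        ≡⟨ cong (2 *_) (lastSum-step m) ⟩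
  2 * (i₁ + i₀ * W)                          ≡⟨ rearrange i₁ i₀ W ⟩
  2 * i₁ + i₀ * (2 * W)                      ≡⟨ cong (λ t → 2 * i₁ + i₀ * t) (2*∑-2+ (1 + m)) ⟩
  2 * i₁ + i₀ * ((1 + m) * (1 + m + 3))      ∎
  where
  open ≡-Reasoning
  i₀ = involutions m
  i₁ = involutions (1 + m)
  W  = ∑[ v ∈ downFrom (1 + m) ] (2 + v)
  rearrange : ∀ i₁ i₀ W → 2 * (i₁ + i₀ * W) ≡ 2 * i₁ + i₀ * (2 * W)
  rearrange = solve-∀

-- The error term 4 Q(n) − n I(n)

∣-∣-cancelʳ : ∀ a b c → ∣ a + c - b + c ∣ ≡ ∣ a - b ∣
∣-∣-cancelʳ a b c = trans (cong₂ ∣_-_∣ (+-comm a c) (+-comm b c)) (∣m+n-m+o∣≡∣n-o∣ c a b)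

∣-∣-+ : ∀ a b c d → ∣ a + b - c + d ∣ ≤ ∣ a - c ∣ + ∣ b - d ∣
∣-∣-+ a b c d = ≤-trans (∣-∣-triangle (a + b) (c + b) (c + d))
                        (≤-reflexive (cong₂ _+_ (∣-∣-cancelʳ a c b) (∣m+n-m+o∣≡∣n-o∣ c b d)))

∣-∣-cross : ∀ a b x y → a + y ≡ b + x → ∣ a - b ∣ ≤ x + y
∣-∣-cross a b x y eq = begin
  ∣ a - b ∣          ≡⟨ sym (∣-∣-cancelʳ a b y) ⟩
  ∣ a + y - b + y ∣  ≡⟨ cong (λ t → ∣ t - b + y ∣) eq ⟩
  ∣ b + x - b + y ∣  ≡⟨ ∣m+n-m+o∣≡∣n-o∣ b x y ⟩
  ∣ x - y ∣          ≤⟨ ∣m-n∣≤m⊔n x y ⟩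
  x ⊔ y              ≤⟨ m⊔n≤m+n x y ⟩
  x + y              ∎
  where open ≤-Reasoning

error : (ℕ → ℕ) → ℕ → ℕ
error S n = ∣ 4 * S n - n * involutions n ∣

total-windowSum-≤ : ∀ p n → total (windowSum (occurs p)) n ≤ n * involutions n
total-windowSum-≤ p n = begin
  total (windowSum (occurs p)) n ≤⟨ ∑-mono-≤ (All.map (λ {σ} (perm , _) → ≤-trans (windowSum-≤-length (occurs-≤1 p) σ)
                                                                             (≤-reflexive (IsPermutation.length≡ perm)))
                                                       (avoiders-sound n)) ⟩
  ∑[ σ ∈ avoiders n ] n           ≡⟨ trans (∑-const (avoiders n) n) (trans (cong (_* n) (length-avoiders n)) (*-comm _ n)) ⟩
  n * involutions n               ∎
  where open ≤-Reasoning

error-≤ : ∀ S n → S n ≤ n * involutions n → error S n ≤ 4 * (n * involutions n)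
error-≤ S n S≤ = ≤-trans (∣m-n∣≤m⊔n (4 * S n) _) (⊔-lub (*-monoʳ-≤ 4 S≤) (m≤n*m _ 4))

slack : ℕ → ℕ
slack m = involutions (3 + m) + 2 * (3 + m) * involutions (2 + m)

involutions-slack : ∀ m → (4 + m) * involutions (4 + m)
                          ≡ (3 + m) * involutions (3 + m) + (3 + m) * ((2 + m) * involutions (2 + m)) + slack m
involutions-slack m = identity m (involutions (3 + m)) (involutions (2 + m))
  where
  identity : ∀ m i₃ i₂ → (4 + m) * (i₃ + (3 + m) * i₂)
                        ≡ (3 + m) * i₃ + (3 + m) * ((2 + m) * i₂) + (i₃ + 2 * (3 + m) * i₂)
  identity = solve-∀

error-step : ∀ S m P a → 4 * S (4 + m) + P ≡ 4 * S (3 + m) + (3 + m) * (4 * S (2 + m)) + a →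
             error S (4 + m) ≤ error S (3 + m) + (3 + m) * error S (2 + m) + ∣ a - slack m + P ∣
error-step S m P a rec = begin
  ∣ X - Y ∣
    ≡⟨ sym (∣-∣-cancelʳ X Y P) ⟩
  ∣ X + P - Y + P ∣
    ≡⟨ cong₂ ∣_-_∣ rec Y+P ⟩
  ∣ A₁ + c * A₂ + a - B₁ + c * B₂ + (slack m + P) ∣
    ≤⟨ ∣-∣-+ (A₁ + c * A₂) a (B₁ + c * B₂) (slack m + P) ⟩
  ∣ A₁ + c * A₂ - B₁ + c * B₂ ∣ + ∣ a - slack m + P ∣
    ≤⟨ +-monoˡ-≤ _ (∣-∣-+ A₁ (c * A₂) B₁ (c * B₂)) ⟩
  ∣ A₁ - B₁ ∣ + ∣ c * A₂ - c * B₂ ∣ + ∣ a - slack m + P ∣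
    ≡⟨ cong (λ t → ∣ A₁ - B₁ ∣ + t + ∣ a - slack m + P ∣) (sym (*-distribˡ-∣-∣ c A₂ B₂)) ⟩
  ∣ A₁ - B₁ ∣ + c * ∣ A₂ - B₂ ∣ + ∣ a - slack m + P ∣
    ∎
  where
  open ≤-Reasoning
  c  = 3 + m
  X  = 4 * S (4 + m)
  Y  = (4 + m) * involutions (4 + m)
  A₁ = 4 * S (3 + m)
  A₂ = 4 * S (2 + m)
  B₁ = (3 + m) * involutions (3 + m)
  B₂ = (2 + m) * involutions (2 + m)
  Y+P : Y + P ≡ B₁ + c * B₂ + (slack m + P)
  Y+P = trans (cong (_+ P) (involutions-slack m)) (+-assoc (B₁ + c * B₂) (slack m) P)

4*-rec : ∀ a b c d e f → a + b ≡ c + d * e + f → 4 * a + 4 * b ≡ 4 * c + d * (4 * e) + 4 * f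
4*-rec a b c d e f eq = trans (sym (*-distribˡ-+ 4 a b)) (trans (cong (4 *_) eq) (identity c d e f))
  where
  identity : ∀ c d e f → 4 * (c + d * e + f) ≡ 4 * c + d * (4 * e) + 4 * f
  identity = solve-∀

forcing : ℕ → ℕ
forcing m = 6 * ((2 + m) * involutions (1 + m))

forcing-312 : ∀ m → ∣ 4 * lastSum (2 + m) - slack m + 0 ∣ ≤ forcing m
forcing-312 m = ≤-trans (∣-∣-cross (4 * lastSum (2 + m)) (slack m + 0) ((1 + m) * i₀) ((3 * m + 5) * i₁) cross) bound
  where
  i₀ = involutions m
  i₁ = involutions (1 + m)
  cross : 4 * lastSum (2 + m) + (3 * m + 5) * i₁ ≡ slack m + 0 + (1 + m) * i₀
  cross = trans (cong (λ t → t + (3 * m + 5) * i₁) (trans (*-assoc 2 2 (lastSum (2 + m))) (cong (2 *_) (2*lastSum m))))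
                (identity m i₀ i₁)
    where
    identity : ∀ m i₀ i₁ → 2 * (2 * i₁ + i₀ * ((1 + m) * (1 + m + 3))) + (3 * m + 5) * i₁
                         ≡ (i₁ + (1 + m) * i₀ + (2 + m) * i₁) + 2 * (3 + m) * (i₁ + (1 + m) * i₀) + 0 + (1 + m) * i₀
    identity = solve-∀
  bound : (1 + m) * i₀ + (3 * m + 5) * i₁ ≤ forcing m
  bound = begin
    (1 + m) * i₀ + (3 * m + 5) * i₁                  ≤⟨ +-monoˡ-≤ _ (*-monoʳ-≤ (1 + m) (involutions-mono m)) ⟩
    (1 + m) * i₁ + (3 * m + 5) * i₁                  ≤⟨ m≤m+n _ ((2 * m + 6) * i₁) ⟩
    (1 + m) * i₁ + (3 * m + 5) * i₁ + (2 * m + 6) * i₁ ≡⟨ identity m i₁ ⟩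
    forcing m                                        ∎
    where
    open ≤-Reasoning
    identity : ∀ m i₁ → (1 + m) * i₁ + (3 * m + 5) * i₁ + (2 * m + 6) * i₁ ≡ 6 * ((2 + m) * i₁)
    identity = solve-∀

forcing-213 : ∀ m → ∣ 4 * ((3 + m) * involutions (2 + m)) - slack m + 4 * lastSum (2 + m) ∣ ≤ forcing m
forcing-213 m = ≤-trans (∣-∣-cross (4 * ((3 + m) * involutions (2 + m))) (slack m + 4 * lastSum (2 + m))
                                   (m * i₁) (i₁ + 3 * (1 + m) * i₀) cross) bound
  where
  i₀ = involutions m
  i₁ = involutions (1 + m)
  cross : 4 * ((3 + m) * involutions (2 + m)) + (i₁ + 3 * (1 + m) * i₀) ≡ slack m + 4 * lastSum (2 + m) + m * i₁
  cross = trans (identity m i₀ i₁)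
                (cong (λ t → slack m + t + m * i₁) (sym (trans (*-assoc 2 2 (lastSum (2 + m))) (cong (2 *_) (2*lastSum m)))))
    where
    identity : ∀ m i₀ i₁ → 4 * ((3 + m) * (i₁ + (1 + m) * i₀)) + (i₁ + 3 * (1 + m) * i₀)
                         ≡ (i₁ + (1 + m) * i₀ + (2 + m) * i₁) + 2 * (3 + m) * (i₁ + (1 + m) * i₀)
                           + 2 * (2 * i₁ + i₀ * ((1 + m) * (1 + m + 3))) + m * i₁
    identity = solve-∀
  bound : m * i₁ + (i₁ + 3 * (1 + m) * i₀) ≤ forcing m
  bound = begin
    m * i₁ + (i₁ + 3 * (1 + m) * i₀)                    ≤⟨ +-monoʳ-≤ (m * i₁) (+-monoʳ-≤ i₁
                                                             (*-monoʳ-≤ (3 * (1 + m)) (involutions-mono m))) ⟩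
    m * i₁ + (i₁ + 3 * (1 + m) * i₁)                    ≤⟨ m≤m+n _ ((2 * m + 8) * i₁) ⟩
    m * i₁ + (i₁ + 3 * (1 + m) * i₁) + (2 * m + 8) * i₁ ≡⟨ identity m i₁ ⟩
    forcing m                                           ∎
    where
    open ≤-Reasoning
    identity : ∀ m i₁ → m * i₁ + (i₁ + 3 * (1 + m) * i₁) + (2 * m + 8) * i₁ ≡ 6 * ((2 + m) * i₁)
    identity = solve-∀

error-312-rec : ∀ m → error (total P312.occurrences) (4 + m)
                      ≤ error (total P312.occurrences) (3 + m) + (3 + m) * error (total P312.occurrences) (2 + m) + forcing m
error-312-rec m = ≤-trans
  (error-step S m 0 (4 * lastSum (2 + m))
              (4*-rec (S (4 + m)) 0 (S (3 + m)) (3 + m) (S (2 + m)) (lastSum (2 + m)) (trans (+-identityʳ _) (total-312-rec (1 + m)))))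
  (+-monoʳ-≤ _ (forcing-312 m))
  where S = total P312.occurrences

error-213-rec : ∀ m → error (total P213.occurrences) (4 + m)
                      ≤ error (total P213.occurrences) (3 + m) + (3 + m) * error (total P213.occurrences) (2 + m) + forcing m
error-213-rec m = ≤-trans
  (error-step S m (4 * lastSum (2 + m)) (4 * ((3 + m) * involutions (2 + m)))
              (4*-rec (S (4 + m)) (lastSum (2 + m)) (S (3 + m)) (3 + m) (S (2 + m)) ((3 + m) * involutions (2 + m))
                         (total-213-rec (1 + m))))
  (+-monoʳ-≤ _ (forcing-213 m))
  where S = total P213.occurrences

-- Growth of I and the size of the error

-- With r = I(n+1)/I(n) this reads n + r ≤ r² ≤ n + 1 + r, an invariant of r ↦ 1 + (n+1)/r.
involutions-ratio² : ∀ n →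
  n * (involutions n * involutions n) + involutions n * involutions (suc n) ≤ involutions (suc n) * involutions (suc n) ×
  involutions (suc n) * involutions (suc n) ≤ suc n * (involutions n * involutions n) + involutions n * involutions (suc n)
involutions-ratio² zero    = ≤-refl , n≤1+n 1
involutions-ratio² (suc n) with involutions-ratio² n
... | lower , upper = lower′ , upper′
  where
  a = involutions n
  b = involutions (suc n)
  c = b + suc n * a
  lower′ : suc n * (b * b) + b * c ≤ c * c
  lower′ = begin
    suc n * (b * b) + b * c       ≤⟨ +-monoˡ-≤ (b * c) (*-monoʳ-≤ (suc n) (subst (b * b ≤_) (identity₁ n a b) upper)) ⟩
    suc n * (a * c) + b * c       ≡⟨ identity₂ n a b ⟩
    c * c                         ∎
    where
    open ≤-Reasoning
    identity₁ : ∀ n a b → suc n * (a * a) + a * b ≡ a * (b + suc n * a)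
    identity₁ = solve-∀
    identity₂ : ∀ n a b → suc n * (a * (b + suc n * a)) + b * (b + suc n * a) ≡ (b + suc n * a) * (b + suc n * a)
    identity₂ = solve-∀
  upper′ : c * c ≤ suc (suc n) * (b * b) + b * c
  upper′ = +-cancelʳ-≤ (a * b) _ _ (begin
    c * c + a * b                                         ≡⟨ identity₃ n a b ⟩
    b * c + (suc (suc n) * (n * (a * a) + a * b) + a * a) ≤⟨ +-monoʳ-≤ (b * c) (+-mono-≤ (*-monoʳ-≤ (suc (suc n)) lower)
                                                                                         (*-monoʳ-≤ a (involutions-mono n))) ⟩
    b * c + (suc (suc n) * (b * b) + a * b)               ≡⟨ identity₄ n a b ⟩
    suc (suc n) * (b * b) + b * c + a * b                 ∎)
    where
    open ≤-Reasoning
    identity₃ : ∀ n a b → (b + suc n * a) * (b + suc n * a) + a * b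
                          ≡ b * (b + suc n * a) + (suc (suc n) * (n * (a * a) + a * b) + a * a)
    identity₃ = solve-∀
    identity₄ : ∀ n a b → b * (b + suc n * a) + (suc (suc n) * (b * b) + a * b)
                          ≡ suc (suc n) * (b * b) + b * (b + suc n * a) + a * b
    identity₄ = solve-∀

involutions-growth : ∀ K m → 36 * (K * K) ≤ suc m → 6 * K * involutions (suc m) ≤ involutions (suc (suc m))
involutions-growth K m 36K²≤ = ≤-square⁻¹ (begin
  6 * K * i₁ * (6 * K * i₁)       ≡⟨ identity K i₁ ⟩
  36 * (K * K) * (i₁ * i₁)        ≤⟨ *-monoˡ-≤ (i₁ * i₁) 36K²≤ ⟩
  suc m * (i₁ * i₁)               ≤⟨ m≤m+n _ _ ⟩
  suc m * (i₁ * i₁) + i₁ * i₂     ≤⟨ proj₁ (involutions-ratio² (suc m)) ⟩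
  i₂ * i₂                         ∎)
  where
  open ≤-Reasoning
  i₁ = involutions (suc m)
  i₂ = involutions (suc (suc m))
  identity : ∀ K x → 6 * K * x * (6 * K * x) ≡ 36 * (K * K) * (x * x)
  identity = solve-∀
  ≤-square⁻¹ : ∀ {x y} → x * x ≤ y * y → x ≤ y
  ≤-square⁻¹ x²≤y² = ≮⇒≥ (λ y<x → <⇒≱ (*-mono-< y<x y<x) x²≤y²)

forcing-absorbed : ∀ K m → 36 * (K * K) ≤ suc m → K * forcing m ≤ involutions (4 + m)
forcing-absorbed K m 36K²≤ = begin
  K * (6 * ((2 + m) * i₁))        ≡⟨ identity K m i₁ ⟩
  (2 + m) * (6 * K * i₁)          ≤⟨ *-monoʳ-≤ (2 + m) (involutions-growth K m 36K²≤) ⟩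
  (2 + m) * involutions (2 + m)   ≤⟨ *-monoˡ-≤ (involutions (2 + m)) (n≤1+n (2 + m)) ⟩
  (3 + m) * involutions (2 + m)   ≤⟨ m≤n+m _ (involutions (3 + m)) ⟩
  involutions (4 + m)             ∎
  where
  open ≤-Reasoning
  i₁ = involutions (suc m)
  identity : ∀ K m x → K * (6 * ((2 + m) * x)) ≡ (2 + m) * (6 * K * x)
  identity = solve-∀

IsLittleO : (ℕ → ℕ) → (ℕ → ℕ) → Set
IsLittleO f g = ∀ K → ∃[ N ] ∀ n → N ≤ n → K * f n ≤ g n

-- Once 36K² ≤ m + 1 the inhomogeneous term is dominated (forcing-absorbed), so the bound
-- K e(n) ≤ (A + n) I(n) propagates along I(n+2) = I(n+1) + (n+1) I(n); the crude bound
-- e(n) ≤ 4n I(n) provides the two starting values.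
module ErrorBound (S : ℕ → ℕ)
                  (error-rec : ∀ m → error S (4 + m) ≤ error S (3 + m) + (3 + m) * error S (2 + m) + forcing m)
                  (S≤ : ∀ n → S n ≤ n * involutions n) where

  private
    e : ℕ → ℕ
    e = error S

    M : ℕ → ℕ
    M K = 36 * (K * K)

    A : ℕ → ℕ
    A K = 4 * K * (3 + M K)

    Bounded : ℕ → ℕ → Set
    Bounded K n = K * e n ≤ (A K + n) * involutions n

    bounded-initially : ∀ K n → n ≤ 3 + M K → Bounded K n
    bounded-initially K n n≤ = begin
      K * e n                          ≤⟨ *-monoʳ-≤ K (error-≤ S n (S≤ n)) ⟩
      K * (4 * (n * involutions n))    ≡⟨ identity K n (involutions n) ⟩
      4 * K * n * involutions n        ≤⟨ *-monoˡ-≤ (involutions n) (*-monoʳ-≤ (4 * K) n≤) ⟩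
      A K * involutions n              ≤⟨ *-monoˡ-≤ (involutions n) (m≤m+n (A K) n) ⟩
      (A K + n) * involutions n        ∎
      where
      open ≤-Reasoning
      identity : ∀ K n i → K * (4 * (n * i)) ≡ 4 * K * n * i
      identity = solve-∀

    bounded-step : ∀ K m → M K ≤ m → Bounded K (2 + m) → Bounded K (3 + m) → Bounded K (4 + m)
    bounded-step K m M≤m b₂ b₃ = begin
      K * e (4 + m)
        ≤⟨ *-monoʳ-≤ K (error-rec m) ⟩
      K * (e (3 + m) + (3 + m) * e (2 + m) + forcing m)
        ≡⟨ identity₁ K (e (3 + m)) m (e (2 + m)) (forcing m) ⟩
      K * e (3 + m) + (3 + m) * (K * e (2 + m)) + K * forcing m
        ≤⟨ +-mono-≤ (+-mono-≤ b₃ (*-monoʳ-≤ (3 + m) (≤-trans b₂ (*-monoˡ-≤ i₂ (+-monoʳ-≤ (A K) (n≤1+n _))))))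
                    (forcing-absorbed K m (≤-trans M≤m (n≤1+n m))) ⟩
      (A K + (3 + m)) * i₃ + (3 + m) * ((A K + (3 + m)) * i₂) + (i₃ + (3 + m) * i₂)
        ≡⟨ identity₂ (A K) m i₃ i₂ ⟩
      (A K + (4 + m)) * involutions (4 + m)
        ∎
      where
      open ≤-Reasoning
      i₂ = involutions (2 + m)
      i₃ = involutions (3 + m)
      identity₁ : ∀ K a m b c → K * (a + (3 + m) * b + c) ≡ K * a + (3 + m) * (K * b) + K * c
      identity₁ = solve-∀
      identity₂ : ∀ A m i₃ i₂ → (A + (3 + m)) * i₃ + (3 + m) * ((A + (3 + m)) * i₂) + (i₃ + (3 + m) * i₂)
                                ≡ (A + (4 + m)) * (i₃ + (3 + m) * i₂)
      identity₂ = solve-∀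

    bounded-from : ∀ K j → Bounded K (2 + (j + M K)) × Bounded K (3 + (j + M K))
    bounded-from K zero    = bounded-initially K _ (n≤1+n _) , bounded-initially K _ ≤-refl
    bounded-from K (suc j) = let b₂ , b₃ = bounded-from K j in b₃ , bounded-step K (j + M K) (m≤n+m (M K) j) b₂ b₃

    bounded-eventually : ∀ K n → 2 + M K ≤ n → Bounded K n
    bounded-eventually K n 2+M≤n with m≤n⇒∃[o]m+o≡n 2+M≤n
    ... | j , refl = subst (Bounded K) (cong (2 +_) (+-comm j (M K))) (proj₁ (bounded-from K j))

  error-littleO : IsLittleO (error S) (λ n → n * involutions n)
  error-littleO K = A (2 * K) + (2 + M (2 * K)) , λ n N≤n → *-cancelˡ-≤ 2 (begin
    2 * (K * e n)                       ≡⟨ sym (*-assoc 2 K (e n)) ⟩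
    2 * K * e n                         ≤⟨ bounded-eventually (2 * K) n (≤-trans (m≤n+m _ (A (2 * K))) N≤n) ⟩
    (A (2 * K) + n) * involutions n     ≤⟨ *-monoˡ-≤ (involutions n) (+-monoˡ-≤ n (≤-trans A≤N N≤n)) ⟩
    (n + n) * involutions n             ≡⟨ identity n (involutions n) ⟩
    2 * (n * involutions n)             ∎)
    where
    open ≤-Reasoning
    A≤N : A (2 * K) ≤ A (2 * K) + (2 + M (2 * K))
    A≤N = m≤m+n (A (2 * K)) (2 + M (2 * K))
    identity : ∀ n i → (n + n) * i ≡ 2 * (n * i)
    identity = solve-∀

-- Convergence of the ratio

∣⊖∣≡∣-∣ : ∀ m n → ℤ.∣ m ⊖ n ∣ ≡ ∣ m - n ∣
∣⊖∣≡∣-∣ zero    zero    = refl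
∣⊖∣≡∣-∣ zero    (suc n) = refl
∣⊖∣≡∣-∣ (suc m) zero    = refl
∣⊖∣≡∣-∣ (suc m) (suc n) = trans (cong ℤ.∣_∣ (ℤ.[1+m]⊖[1+n]≡m⊖n m n)) (∣⊖∣≡∣-∣ m n)

∣S/k-¼∣< : ∀ S k p d .(c : Coprime (suc p) (suc d)) → ∣ 4 * S - suc k ∣ * suc d < suc p * (suc k * 4) →
           ℚ.∣ (ℤ.+ S) / suc k ℚ.- (ℤ.+ 1) / 4 ∣ ℚ.< mkℚ (ℤ.+ suc p) d c
∣S/k-¼∣< S k p d c lt = ℚ.toℚᵘ-cancel-< (ℚᵘ.<-respˡ-≃ (ℚᵘ.≃-sym toℚᵘ-difference) difference<)
  where
  X = (ℤ.+ S) / suc k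
  Y = (ℤ.+ 1) / 4
  toℚᵘ-difference : ℚ.toℚᵘ (ℚ.∣ X ℚ.- Y ∣) ℚᵘ.≃ ℚᵘ.∣ ℚᵘ.mkℚᵘ (ℤ.+ S) k ℚᵘ.- ℚᵘ.mkℚᵘ (ℤ.+ 1) 3 ∣
  toℚᵘ-difference =
    ℚᵘ.≃-trans (ℚ.toℚᵘ-homo-∣-∣ (X ℚ.- Y))
               (ℚᵘ.∣-∣-cong (ℚᵘ.≃-trans (ℚ.toℚᵘ-homo-+ X (ℚ.- Y))
                                        (ℚᵘ.+-cong (ℚ.toℚᵘ-fromℚᵘ (ℚᵘ.mkℚᵘ (ℤ.+ S) k)) (ℚ.toℚᵘ-homo‿- Y))))
  numerator : ℤ.∣ ℤ.+ S ℤ.* ℤ.+ 4 ℤ.+ ℤ.- (ℤ.+ 1) ℤ.* ℤ.+ suc k ∣ ≡ ∣ 4 * S - suc k ∣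
  numerator = trans (cong ℤ.∣_∣ (trans (identity (ℤ.+ S) (ℤ.+ suc k)) (cong (ℤ._- ℤ.+ suc k) (sym (ℤ.pos-* 4 S)))))
                    (trans (cong ℤ.∣_∣ (ℤ.m-n≡m⊖n (4 * S) (suc k))) (∣⊖∣≡∣-∣ (4 * S) (suc k)))
    where
    identity : ∀ s t → s ℤ.* ℤ.+ 4 ℤ.+ ℤ.- (ℤ.+ 1) ℤ.* t ≡ ℤ.+ 4 ℤ.* s ℤ.- t
    identity = ℤ-solve-∀
  difference< : ℚᵘ.∣ ℚᵘ.mkℚᵘ (ℤ.+ S) k ℚᵘ.- ℚᵘ.mkℚᵘ (ℤ.+ 1) 3 ∣ ℚᵘ.< ℚᵘ.mkℚᵘ (ℤ.+ suc p) d
  difference< = ℚᵘ.*<* (subst₂ ℤ._<_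
    (trans (ℤ.pos-* ∣ 4 * S - suc k ∣ (suc d)) (cong (λ n → ℤ.+ n ℤ.* ℤ.+ suc d) (sym numerator)))
    (ℤ.pos-* (suc p) (suc k * 4))
    (ℤ.+<+ lt))

popRatio≡ : ∀ ps p n k → n * length (Av ps n) ≡ suc k → popRatio ps p n ≡ (ℤ.+ totalOcc ps p n) / suc k
popRatio≡ ps p n k eq with n * length (Av ps n) | eq
... | .(suc k) | refl = refl

popEq-of-littleO : ∀ {ps p} {S c : ℕ → ℕ} → (∀ n → totalOcc ps p n ≡ S n) → (∀ n → length (Av ps n) ≡ c n) →
                   (∀ n → 1 ≤ c n) → IsLittleO (λ n → ∣ 4 * S n - n * c n ∣) (λ n → n * c n) →
                   PopEq ps p ((ℤ.+ 1) / 4)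
popEq-of-littleO {ps} {p} {S} {c} total≡ length≡ c-pos littleO (mkℚ (ℤ.+ suc q) d coprime) _ = suc N , close
  where
  N : ℕ
  N = proj₁ (littleO (suc d))
  close : ∀ n → suc N ≤ n → ℚ.∣ popRatio ps p n ℚ.- (ℤ.+ 1) / 4 ∣ ℚ.< mkℚ (ℤ.+ suc q) d coprime
  close n 1+N≤n with m≤n⇒∃[o]m+o≡n (*-mono-≤ (≤-trans (s≤s z≤n) 1+N≤n) (c-pos n))
  ... | k , 1+k≡nc = subst (λ r → ℚ.∣ r ℚ.- (ℤ.+ 1) / 4 ∣ ℚ.< mkℚ (ℤ.+ suc q) d coprime)
                           (sym (trans (popRatio≡ ps p n k (trans (cong (n *_) (length≡ n)) (sym 1+k≡nc)))
                                       (cong (λ t → (ℤ.+ t) / suc k) (total≡ n))))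
                           (∣S/k-¼∣< (S n) k q d coprime (begin-strict
      ∣ 4 * S n - suc k ∣ * suc d     ≡⟨ cong (λ t → ∣ 4 * S n - t ∣ * suc d) 1+k≡nc ⟩
      ∣ 4 * S n - n * c n ∣ * suc d   ≡⟨ *-comm _ (suc d) ⟩
      suc d * ∣ 4 * S n - n * c n ∣   ≤⟨ proj₂ (littleO (suc d)) n (≤-trans (n≤1+n N) 1+N≤n) ⟩
      n * c n                         ≡⟨ sym 1+k≡nc ⟩
      suc k                           <⟨ m<m*n (suc k) 4 (s≤s (s≤s z≤n)) ⟩
      suc k * 4                       ≤⟨ m≤n*m (suc k * 4) (suc q) ⟩
      suc q * (suc k * 4)             ∎))
    where open ≤-Reasoning
popEq-of-littleO _ _ _ _ (mkℚ (ℤ.+ zero) _ _) (ℚ.*<* (ℤ.+<+ ()))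
popEq-of-littleO _ _ _ _ (mkℚ ℤ.-[1+ _ ] _ _) (ℚ.*<* ())

-- imported only here: the prefix +_ would make sections (x +_) of ℕ's _+_ ambiguous
open import Data.Integer using (+_)

mainTheorem7 : PopEq ((1 ∷ 2 ∷ 3 ∷ []) ∷ (1 ∷ 3 ∷ 2 ∷ []) ∷ []) (3 ∷ 1 ∷ 2 ∷ []) ((+ 1) / 4)
    × PopEq ((1 ∷ 2 ∷ 3 ∷ []) ∷ (1 ∷ 3 ∷ 2 ∷ []) ∷ []) (2 ∷ 1 ∷ 3 ∷ []) ((+ 1) / 4)
mainTheorem7 =
  popEq-of-littleO (totalOcc≡total 3 1 2) length-Av involutions-pos
    (ErrorBound.error-littleO (total P312.occurrences) error-312-rec (total-windowSum-≤ p312)) ,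
  popEq-of-littleO (totalOcc≡total 2 1 3) length-Av involutions-pos
    (ErrorBound.error-littleO (total P213.occurrences) error-213-rec (total-windowSum-≤ p213))
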